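{- For nonnegative integers $k$ define integers $x_k,y_k$ by $x_k+\sqrt{2}\,y_k=(1+\sqrt{2})^k$. If $j$ is a nonnegative integer and $k=3\cdot 5^j\pm 1$, then $$y_k^2+1\equiv 0\pmod{5^{j+1}}.$$ -}

module Defs where

open import Data.Nat using (ℕ; zero; suc; _+_; _*_)
open import Data.Product using (_×_; _,_; proj₁; proj₂)

-- xy k = (x_k , y_k) where x_k + √2 y_k = (1 + √2)^k.
-- (x + √2 y)(1 + √2) = (x + 2y) + √2 (x + y); all values are nonnegative.
xy : ℕ → ℕ × ℕ
xy zero = 1 , 0
xy (suc k) = let (x , y) = xy k in (x + 2 * y , x + y)

x : ℕ → ℕ
x k = proj₁ (xy k)

y : ℕ → ℕ
y k = proj₂ (xy k)

-- The norm x_k² − 2y_k² of (1 + √2)^k is (−1)^k. For odd m this makes y_{m±1} = x_m ± y_m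
-- satisfy y_{m±1}² + 1 = y_m (3y_m ± 2x_m), so y_m divides y_{m±1}² + 1. It remains that
-- 5^(j+1) divides y_m for m = 3·5^j: y_3 = 5, and expanding (x_n + √2 y_n)^5 modulo y_n²
-- gives y_{5n} ≡ 5x_n⁴y_n, so 5d divides y_{5n} whenever 5 divides d and d divides y_n.
module Submission where

open import Defs
open import Data.Nat using (ℕ; zero; suc; _+_; _*_; _∸_; _^_)
open import Data.Nat.Properties using (+-comm; +-assoc; +-cancelʳ-≡; *-identityʳ)
open import Data.Nat.Divisibility
  using (_∣_; divides; ∣-trans; ∣-refl; _∣0; *-pres-∣; m∣m*n; n∣m*n; ∣m∣n⇒∣m+n; ∣m+n∣m⇒∣n)
open import Data.Product using (_×_; _,_; proj₁; proj₂; ∃; ∃₂; map)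
open import Relation.Binary.PropositionalEquality using (_≡_; refl; sym; trans; cong; cong₂; subst; module ≡-Reasoning)
open import Data.Nat.Tactic.RingSolver using (solve-∀)

-- Multiplication in ℤ[√2], with (a , b) standing for a + b√2.
infixl 7 _·_
infixr 8 _^·_

_·_ : ℕ × ℕ → ℕ × ℕ → ℕ × ℕ
(a , b) · (c , d) = a * c + 2 * b * d , a * d + b * c

_^·_ : ℕ × ℕ → ℕ → ℕ × ℕ
p ^· zero  = 1 , 0
p ^· suc k = p · p ^· k

xy-+ : ∀ m n → xy (m + n) ≡ xy m · xy n
xy-+ zero    n = cong₂ _,_ (unitˡ (x n) (y n)) (unitʳ (x n) (y n))
  where
  unitˡ : ∀ a b → a ≡ 1 * a + 2 * 0 * b
  unitˡ = solve-∀
  unitʳ : ∀ a b → b ≡ 1 * b + 0 * a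
  unitʳ = solve-∀
xy-+ (suc m) n rewrite xy-+ m n = cong₂ _,_ (assoc₁ (x m) (y m) (x n) (y n)) (assoc₂ (x m) (y m) (x n) (y n))
  where
  assoc₁ : ∀ a b c d → (a * c + 2 * b * d) + 2 * (a * d + b * c) ≡ (a + 2 * b) * c + 2 * (a + b) * d
  assoc₁ = solve-∀
  assoc₂ : ∀ a b c d → (a * c + 2 * b * d) + (a * d + b * c) ≡ (a + 2 * b) * d + (a + b) * c
  assoc₂ = solve-∀

xy-* : ∀ k n → xy (k * n) ≡ xy n ^· k
xy-* zero    n = refl
xy-* (suc k) n = trans (xy-+ n (k * n)) (cong (xy n ·_) (xy-* k n))

^·-mod-b² : ∀ a b k → ∃₂ λ c c′ →
  proj₁ ((a , b) ^· suc k) ≡ a ^ suc k + b * b * c ×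
  proj₂ ((a , b) ^· suc k) ≡ suc k * (a ^ k * b) + b * b * c′
^·-mod-b² a b zero = 0 , 0 , proj₁-eq a b , proj₂-eq a b
  where
  proj₁-eq : ∀ a b → a * 1 + 2 * b * 0 ≡ a * 1 + b * b * 0
  proj₁-eq = solve-∀
  proj₂-eq : ∀ a b → a * 0 + b * 1 ≡ 1 * (1 * b) + b * b * 0
  proj₂-eq = solve-∀
^·-mod-b² a b (suc k) with ^·-mod-b² a b k
... | c , c′ , eq₁ , eq₂ =
  a * c + 2 * (suc k * a ^ k + b * c′) , a * c′ + b * c ,
  trans (cong₂ (λ u v → a * u + 2 * b * v) eq₁ eq₂) (proj₁-eq a b c c′ (a ^ k) k) ,
  trans (cong₂ (λ u v → a * v + b * u) eq₁ eq₂) (proj₂-eq a b c c′ (a ^ k) k)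
  where
  proj₁-eq : ∀ a b c c′ t k → a * (a * t + b * b * c) + 2 * b * ((1 + k) * (t * b) + b * b * c′)
                            ≡ a * (a * t) + b * b * (a * c + 2 * ((1 + k) * t + b * c′))
  proj₁-eq = solve-∀
  proj₂-eq : ∀ a b c c′ t k → a * ((1 + k) * (t * b) + b * b * c′) + b * (a * t + b * b * c)
                            ≡ (2 + k) * (a * t * b) + b * b * (a * c′ + b * c)
  proj₂-eq = solve-∀

k∣d∣y[n]⇒k*d∣y[k*n] : ∀ k {d} n → k ∣ d → d ∣ y n → k * d ∣ y (k * n)
k∣d∣y[n]⇒k*d∣y[k*n] zero    {d} n k∣d d∣y = 0 ∣0
k∣d∣y[n]⇒k*d∣y[k*n] (suc k) {d} n k∣d d∣y with ^·-mod-b² (x n) (y n) k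
... | _ , c′ , _ , eq = subst (suc k * d ∣_) (sym (trans (cong proj₂ (xy-* (suc k) n)) eq))
  (∣m∣n⇒∣m+n (*-pres-∣ (∣-refl {suc k}) (∣-trans d∣y (n∣m*n (x n ^ k))))
             (∣-trans (*-pres-∣ (∣-trans k∣d d∣y) d∣y) (m∣m*n c′)))

5^[1+j]∣y[3·5^j] : ∀ j → 5 ^ (j + 1) ∣ y (3 * 5 ^ j)
5^[1+j]∣y[3·5^j] zero    = divides 1 refl
5^[1+j]∣y[3·5^j] (suc j) = subst (λ m → 5 ^ (suc j + 1) ∣ y m) (sym (swap (5 ^ j)))
  (k∣d∣y[n]⇒k*d∣y[k*n] 5 (3 * 5 ^ j) 5∣5^[j+1] (5^[1+j]∣y[3·5^j] j))
  where
  swap : ∀ z → 3 * (5 * z) ≡ 5 * (3 * z)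
  swap = solve-∀
  5∣5^[j+1] : 5 ∣ 5 ^ (j + 1)
  5∣5^[j+1] = subst (λ e → 5 ∣ 5 ^ e) (+-comm 1 j) (m∣m*n (5 ^ j))

m+n≡o+p∧n+1≡p⇒m≡o+1 : ∀ {m n o p} → m + n ≡ o + p → n + 1 ≡ p → m ≡ o + 1
m+n≡o+p∧n+1≡p⇒m≡o+1 {m} {n} {o} {p} m+n≡o+p n+1≡p = +-cancelʳ-≡ p m (o + 1) (begin
  m + p         ≡⟨ cong (m +_) (sym n+1≡p) ⟩
  m + (n + 1)   ≡⟨ +-assoc m n 1 ⟨
  m + n + 1     ≡⟨ cong (_+ 1) m+n≡o+p ⟩
  o + p + 1     ≡⟨ +-shift o p ⟩
  o + 1 + p     ∎)
  where
  open ≡-Reasoning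
  +-shift : ∀ o p → o + p + 1 ≡ o + 1 + p
  +-shift = solve-∀

x[1+k]²+x[k]²≡2y[1+k]²+2y[k]² : ∀ k → x (suc k) * x (suc k) + x k * x k ≡ 2 * y (suc k) * y (suc k) + 2 * y k * y k
x[1+k]²+x[k]²≡2y[1+k]²+2y[k]² k = identity (x k) (y k)
  where
  identity : ∀ a b → (a + 2 * b) * (a + 2 * b) + a * a ≡ 2 * (a + b) * (a + b) + 2 * b * b
  identity = solve-∀

pell : ∀ s → x (s * 2) * x (s * 2) ≡ 2 * y (s * 2) * y (s * 2) + 1
           × x (1 + s * 2) * x (1 + s * 2) + 1 ≡ 2 * y (1 + s * 2) * y (1 + s * 2)
pell zero    = refl , refl
pell (suc s) = even , odd
  where
  m : ℕ
  m = 1 + s * 2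
  even : x (suc m) * x (suc m) ≡ 2 * y (suc m) * y (suc m) + 1
  even = m+n≡o+p∧n+1≡p⇒m≡o+1 (x[1+k]²+x[k]²≡2y[1+k]²+2y[k]² m) (proj₂ (pell s))
  odd : x (2 + m) * x (2 + m) + 1 ≡ 2 * y (2 + m) * y (2 + m)
  odd = sym (m+n≡o+p∧n+1≡p⇒m≡o+1 (sym (x[1+k]²+x[k]²≡2y[1+k]²+2y[k]² (suc m))) (sym even))

Odd : ℕ → Set
Odd m = ∃ λ s → m ≡ 1 + s * 2

odd-* : ∀ {m n} → Odd m → Odd n → Odd (m * n)
odd-* (a , refl) (b , refl) = a + b + a * b * 2 , identity a b
  where
  identity : ∀ a b → (1 + a * 2) * (1 + b * 2) ≡ 1 + (a + b + a * b * 2) * 2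
  identity = solve-∀

odd-^ : ∀ {m} → Odd m → ∀ k → Odd (m ^ k)
odd-^ odd zero    = 0 , refl
odd-^ odd (suc k) = odd-* odd (odd-^ odd k)

a²+1≡2b²⇒[a+b]²+1≡[3b+2a]b : ∀ a b → a * a + 1 ≡ 2 * b * b → (a + b) ^ 2 + 1 ≡ (3 * b + 2 * a) * b
a²+1≡2b²⇒[a+b]²+1≡[3b+2a]b a b a²+1≡2b² = begin
  (a + b) ^ 2 + 1               ≡⟨ cong (λ t → (a + b) * t + 1) (*-identityʳ (a + b)) ⟩
  (a + b) * (a + b) + 1         ≡⟨ expand a b ⟩
  (a * a + 1) + b * (2 * a + b) ≡⟨ cong (_+ b * (2 * a + b)) a²+1≡2b² ⟩
  2 * b * b + b * (2 * a + b)   ≡⟨ collect a b ⟩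
  (3 * b + 2 * a) * b           ∎
  where
  open ≡-Reasoning
  expand : ∀ a b → (a + b) * (a + b) + 1 ≡ (a * a + 1) + b * (2 * a + b)
  expand = solve-∀
  collect : ∀ a b → 2 * b * b + b * (2 * a + b) ≡ (3 * b + 2 * a) * b
  collect = solve-∀

a²≡2b²+1⇒[a+b]a≡[a+b]b+b²+1 : ∀ a b → a * a ≡ 2 * b * b + 1 → (a + b) * a ≡ (a + b) * b + (b ^ 2 + 1)
a²≡2b²+1⇒[a+b]a≡[a+b]b+b²+1 a b a²≡2b²+1 = begin
  (a + b) * a                   ≡⟨ expand a b ⟩
  a * a + b * a                 ≡⟨ cong (_+ b * a) a²≡2b²+1 ⟩
  2 * b * b + 1 + b * a         ≡⟨ collect a b ⟩
  (a + b) * b + (b * b + 1)     ≡⟨ cong (λ t → (a + b) * b + (b * t + 1)) (*-identityʳ b) ⟨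
  (a + b) * b + (b ^ 2 + 1)     ∎
  where
  open ≡-Reasoning
  expand : ∀ a b → (a + b) * a ≡ a * a + b * a
  expand = solve-∀
  collect : ∀ a b → 2 * b * b + 1 + b * a ≡ (a + b) * b + (b * b + 1)
  collect = solve-∀

y[odd]∣y[odd±1]²+1 : ∀ {m} → Odd m → y m ∣ y (m + 1) ^ 2 + 1 × y m ∣ y (m ∸ 1) ^ 2 + 1
y[odd]∣y[odd±1]²+1 (s , refl) = subst (λ n → y m ∣ y n ^ 2 + 1) (+-comm 1 m) next , previous
  where
  m : ℕ
  m = 1 + s * 2
  next : y m ∣ y (suc m) ^ 2 + 1
  next = divides (3 * y m + 2 * x m) (a²+1≡2b²⇒[a+b]²+1≡[3b+2a]b (x m) (y m) (proj₂ (pell s)))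
  n : ℕ
  n = s * 2
  previous : y m ∣ y n ^ 2 + 1
  previous = ∣m+n∣m⇒∣n (subst (y m ∣_) (a²≡2b²+1⇒[a+b]a≡[a+b]b+b²+1 (x n) (y n) (proj₁ (pell s))) (m∣m*n (x n)))
                       (m∣m*n (y n))

lemma4 : (j : ℕ) → (5 ^ (j + 1) ∣ y (3 * 5 ^ j + 1) ^ 2 + 1) × (5 ^ (j + 1) ∣ y (3 * 5 ^ j ∸ 1) ^ 2 + 1)
lemma4 j = map (∣-trans 5^[1+j]∣y[m]) (∣-trans 5^[1+j]∣y[m]) (y[odd]∣y[odd±1]²+1 m-odd)
  where
  5^[1+j]∣y[m] : 5 ^ (j + 1) ∣ y (3 * 5 ^ j)
  5^[1+j]∣y[m] = 5^[1+j]∣y[3·5^j] j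
  m-odd : Odd (3 * 5 ^ j)
  m-odd = odd-* (1 , refl) (odd-^ (2 , refl) j)
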